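{- Let $n\ge1$. If $r$ and $s$ are adjacent in the support-level graph $\mathcal L_n^\sigma$, then $|r-s|\le 2$.
   Context: $G_n$ is the partition graph: its vertices are the partitions of $n$, and two distinct partitions $\lambda\neq\mu$ are adjacent when $\mu$ is obtained from $\lambda$ by moving one cell from one part (of size $x$, the part shrinking to $x-1$ and disappearing if $x=1$) to another part or to a new part of size $1$, followed by reordering the parts in weakly decreasing order. $\sigma(\lambda)$ is the number of distinct part sizes of $\lambda$, and $\rho(n)=\max\{r:r(r+1)/2\le n\}$. The support-level graph $\mathcal L_n^\sigma$ has vertex set $\{1,\dots,\rho(n)\}$, with $r$ and $s$ adjacent if there is an edge $\lambda\mu$ of $G_n$ with $\sigma(\lambda)=r$ and $\sigma(\mu)=s$. -}

module Defs where

open import Data.Nat using (ℕ; zero; suc; _+_; _*_; _∸_; _≤_; _<_; _≤?_; _≟_)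
open import Data.List using (List; []; _∷_; length; deduplicate)
open import Data.Nat.ListAction using (sum)
open import Data.List.Relation.Unary.All using (All)
open import Data.List.Relation.Unary.Linked using (Linked)
open import Data.List.Relation.Binary.Permutation.Propositional using (_↭_)
open import Data.Product using (_×_; Σ; ∃; ∃-syntax)
open import Data.Sum using (_⊎_)
open import Relation.Binary.PropositionalEquality using (_≡_; _≢_)
open import Relation.Nullary.Decidable using (does)
open import Data.Bool using (if_then_else_)

IsPartition : ℕ → List ℕ → Set
IsPartition n λs = Linked (λ a b → b ≤ a) λs × All (λ x → 0 < x) λs × sum λs ≡ n

-- apply f to the entry at (0-based) position i (no-op if out of range)
modifyAt : ℕ → (ℕ → ℕ) → List ℕ → List ℕ
modifyAt i       f []       = []
modifyAt zero    f (x ∷ xs) = f x ∷ xs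
modifyAt (suc i) f (x ∷ xs) = x ∷ modifyAt i f xs

-- delete parts equal to 0 (a part of size 1 that lost its cell disappears)
dropZeros : List ℕ → List ℕ
dropZeros []             = []
dropZeros (zero ∷ xs)    = dropZeros xs
dropZeros (suc x ∷ xs)   = suc x ∷ dropZeros xs

-- μ is obtained from λ by moving one cell from the part at position i
-- to the part at another position j, or to a new part of size 1, and
-- then reordering (μ is a permutation of the resulting multiset of parts).
MoveCell : List ℕ → List ℕ → Set
MoveCell λs μ =
  Σ ℕ λ i → i < length λs ×
    ((Σ ℕ λ j → j < length λs × j ≢ i ×
        μ ↭ dropZeros (modifyAt j suc (modifyAt i (λ x → x ∸ 1) λs)))
     ⊎ (μ ↭ (1 ∷ dropZeros (modifyAt i (λ x → x ∸ 1) λs))))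

Edge : ℕ → List ℕ → List ℕ → Set
Edge n λs μ = IsPartition n λs × IsPartition n μ × λs ≢ μ × MoveCell λs μ

σ : List ℕ → ℕ
σ λs = length (deduplicate _≟_ λs)

-- ρ(n) = max { r : r(r+1)/2 ≤ n }, computed as the largest r ≤ n with r(r+1) ≤ 2n
ρ-aux : ℕ → ℕ → ℕ
ρ-aux n zero    = zero
ρ-aux n (suc k) = if does (suc k * suc (suc k) ≤? 2 * n) then suc k else ρ-aux n k

ρ : ℕ → ℕ
ρ n = ρ-aux n n

LevelAdj : ℕ → ℕ → ℕ → Set
LevelAdj n r s =
  (1 ≤ r × r ≤ ρ n) × (1 ≤ s × s ≤ ρ n) ×
  ∃[ λs ] ∃[ μ ] (Edge n λs μ × σ λs ≡ r × σ μ ≡ s)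

{-# OPTIONS --safe #-}
-- Moving one cell changes the multiset of parts in at most two places: the
-- shrinking part x becomes x - 1 (or vanishes) and the receiving part y becomes
-- y + 1 (or a new part 1 appears). Hence each set of part sizes is contained in
-- the other together with at most two extra values, and the number of distinct
-- part sizes changes by at most 2.
module Submission where

open import Defs
open import Data.Nat using (ℕ; zero; suc; _+_; _≤_; _<_; _∸_; _≟_; z≤n; s≤s)
open import Data.Nat.Properties using (+-comm; m≤n+o⇒m∸n≤o; module ≤-Reasoning)
open import Data.Product using (_×_; _,_; ∃₂; ∃-syntax)
open import Data.Sum using (inj₁; inj₂)
open import Data.Empty using (⊥-elim)
open import Data.List using (List; []; _∷_; _++_; length; deduplicate)
open import Data.List.Properties using (length-++; length-removeAt′)
open import Data.List.Relation.Unary.All using (All)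
import Data.List.Relation.Unary.All as All
open import Data.List.Relation.Unary.Any using (here; there; index; _─_)
open import Data.List.Relation.Unary.AllPairs using ([]; _∷_)
open import Data.List.Relation.Unary.Unique.Propositional using (Unique)
open import Data.List.Relation.Unary.Unique.DecPropositional.Properties _≟_ using (deduplicate-!)
open import Data.List.Membership.Propositional using (_∈_)
open import Data.List.Membership.Propositional.Properties
  using (∈-++⁺ˡ; ∈-++⁺ʳ; ∈-++⁻; ∈-deduplicate⁺; ∈-deduplicate⁻)
open import Data.List.Relation.Binary.Subset.Propositional using (_⊆_)
open import Data.List.Relation.Binary.Subset.Propositional.Properties
  using (⊆-trans; ⊆-reflexive-↭; ∷⁺ʳ; module ⊆-Reasoning)
open import Data.List.Relation.Binary.Permutation.Propositional using (↭-sym; ↭-swap; ↭-refl)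
open import Relation.Binary.PropositionalEquality using (_≢_; refl; sym)

private variable
  A : Set
  x y : A
  xs ys : List A

∈-─ : (x∈ys : x ∈ ys) → y ∈ ys → y ≢ x → y ∈ (ys ─ x∈ys)
∈-─ (here refl)  (here refl)  y≢x = ⊥-elim (y≢x refl)
∈-─ (here refl)  (there y∈ys) _   = y∈ys
∈-─ (there _)    (here refl)  _   = here refl
∈-─ (there x∈ys) (there y∈ys) y≢x = there (∈-─ x∈ys y∈ys y≢x)

Unique-⊆⇒length-≤ : Unique xs → xs ⊆ ys → length xs ≤ length ys
Unique-⊆⇒length-≤ [] _ = z≤n
Unique-⊆⇒length-≤ {xs = x ∷ xs} {ys} (x∉xs ∷ xs!) x∷xs⊆ys = begin
  suc (length xs)          ≤⟨ s≤s (Unique-⊆⇒length-≤ xs! xs⊆ys─x) ⟩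
  suc (length (ys ─ x∈ys)) ≡⟨ sym (length-removeAt′ ys (index x∈ys)) ⟩
  length ys                ∎
  where
  open ≤-Reasoning
  x∈ys : x ∈ ys
  x∈ys = x∷xs⊆ys (here refl)
  xs⊆ys─x : xs ⊆ (ys ─ x∈ys)
  xs⊆ys─x y∈xs = ∈-─ x∈ys (x∷xs⊆ys (there y∈xs)) (λ y≡x → All.lookup x∉xs y∈xs (sym y≡x))

σ-⊆-++ : (zs : List ℕ) {xs ys : List ℕ} → xs ⊆ zs ++ ys → σ xs ≤ σ ys + length zs
σ-⊆-++ zs {xs} {ys} xs⊆zs++ys = begin
  σ xs                              ≤⟨ Unique-⊆⇒length-≤ (deduplicate-! xs) dedup⊆ ⟩
  length (zs ++ deduplicate _≟_ ys) ≡⟨ length-++ zs ⟩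
  length zs + σ ys                  ≡⟨ +-comm (length zs) (σ ys) ⟩
  σ ys + length zs                  ∎
  where
  open ≤-Reasoning
  dedup⊆ : deduplicate _≟_ xs ⊆ zs ++ deduplicate _≟_ ys
  dedup⊆ v∈ with ∈-++⁻ zs (xs⊆zs++ys (∈-deduplicate⁻ _≟_ xs v∈))
  ... | inj₁ v∈zs = ∈-++⁺ˡ v∈zs
  ... | inj₂ v∈ys = ∈-++⁺ʳ zs (∈-deduplicate⁺ _≟_ v∈ys)

σ-∸-≤ : (zs : List ℕ) {xs ys : List ℕ} → xs ⊆ zs ++ ys → σ xs ∸ σ ys ≤ length zs
σ-∸-≤ zs {xs} {ys} xs⊆zs++ys = m≤n+o⇒m∸n≤o (σ xs) (σ ys) (σ-⊆-++ zs xs⊆zs++ys)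

dropZeros-⊆ : (xs : List ℕ) → dropZeros xs ⊆ xs
dropZeros-⊆ (zero ∷ xs)  v∈          = there (dropZeros-⊆ xs v∈)
dropZeros-⊆ (suc _ ∷ _)  (here refl) = here refl
dropZeros-⊆ (suc _ ∷ xs) (there v∈)  = there (dropZeros-⊆ xs v∈)

∈-dropZeros⁺ : {v : ℕ} (xs : List ℕ) → v ∈ xs → 0 < v → v ∈ dropZeros xs
∈-dropZeros⁺ (zero ∷ _)   (here refl) ()
∈-dropZeros⁺ (suc _ ∷ _)  (here refl) _   = here refl
∈-dropZeros⁺ (zero ∷ xs)  (there v∈)  0<v = ∈-dropZeros⁺ xs v∈ 0<v
∈-dropZeros⁺ (suc _ ∷ xs) (there v∈)  0<v = there (∈-dropZeros⁺ xs v∈ 0<v)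

⊆-++-dropZeros : (zs : List ℕ) {xs ys : List ℕ} → All (0 <_) xs →
                 xs ⊆ zs ++ ys → xs ⊆ zs ++ dropZeros ys
⊆-++-dropZeros zs {ys = ys} positive xs⊆zs++ys v∈xs with ∈-++⁻ zs (xs⊆zs++ys v∈xs)
... | inj₁ v∈zs = ∈-++⁺ˡ v∈zs
... | inj₂ v∈ys = ∈-++⁺ʳ zs (∈-dropZeros⁺ ys v∈ys (All.lookup positive v∈xs))

modifyAt-⊆ : ∀ i f (xs : List ℕ) → ∃[ a ] modifyAt i f xs ⊆ a ∷ xs
modifyAt-⊆ i       f []       = 0 , λ ()
modifyAt-⊆ zero    f (x ∷ xs) = f x , ∷⁺ʳ (f x) there
modifyAt-⊆ (suc i) f (x ∷ xs) with modifyAt-⊆ i f xs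
... | a , sub = a , ⊆-trans (∷⁺ʳ x sub) (⊆-reflexive-↭ (↭-swap x a ↭-refl))

⊆-modifyAt : ∀ i f (xs : List ℕ) → ∃[ a ] xs ⊆ a ∷ modifyAt i f xs
⊆-modifyAt i       f []       = 0 , λ ()
⊆-modifyAt zero    f (x ∷ xs) = x , ∷⁺ʳ x there
⊆-modifyAt (suc i) f (x ∷ xs) with ⊆-modifyAt i f xs
... | a , sub = a , ⊆-trans (∷⁺ʳ x sub) (⊆-reflexive-↭ (↭-swap x a ↭-refl))

MoveCell-⊆ : {λs μ : List ℕ} → MoveCell λs μ → ∃₂ λ a b → μ ⊆ a ∷ b ∷ λs
MoveCell-⊆ {λs} {μ} (i , _ , inj₁ (j , _ , _ , μ↭))
  with modifyAt-⊆ i (_∸ 1) λs | modifyAt-⊆ j suc (modifyAt i (_∸ 1) λs)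
... | a , shrink | b , grow = b , a , (begin
  μ                                                 ⊆⟨ ⊆-reflexive-↭ μ↭ ⟩
  dropZeros (modifyAt j suc (modifyAt i (_∸ 1) λs)) ⊆⟨ dropZeros-⊆ _ ⟩
  modifyAt j suc (modifyAt i (_∸ 1) λs)             ⊆⟨ grow ⟩
  b ∷ modifyAt i (_∸ 1) λs                          ⊆⟨ ∷⁺ʳ b shrink ⟩
  b ∷ a ∷ λs                                        ∎)
  where open ⊆-Reasoning ℕ
MoveCell-⊆ {λs} {μ} (i , _ , inj₂ μ↭) with modifyAt-⊆ i (_∸ 1) λs
... | a , shrink = 1 , a , (begin
  μ                                    ⊆⟨ ⊆-reflexive-↭ μ↭ ⟩
  1 ∷ dropZeros (modifyAt i (_∸ 1) λs) ⊆⟨ ∷⁺ʳ 1 (dropZeros-⊆ _) ⟩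
  1 ∷ modifyAt i (_∸ 1) λs             ⊆⟨ ∷⁺ʳ 1 shrink ⟩
  1 ∷ a ∷ λs                           ∎)
  where open ⊆-Reasoning ℕ

MoveCell-⊇ : {λs μ : List ℕ} → All (0 <_) λs → MoveCell λs μ → ∃₂ λ a b → λs ⊆ a ∷ b ∷ μ
MoveCell-⊇ {λs} {μ} positive (i , _ , inj₁ (j , _ , _ , μ↭))
  with ⊆-modifyAt i (_∸ 1) λs | ⊆-modifyAt j suc (modifyAt i (_∸ 1) λs)
... | a , unshrink | b , ungrow = a , b , (begin
  λs                                                        ⊆⟨ λs⊆a∷b∷moved ⟩
  a ∷ b ∷ dropZeros (modifyAt j suc (modifyAt i (_∸ 1) λs)) ⊆⟨ ∷⁺ʳ a (∷⁺ʳ b (⊆-reflexive-↭ (↭-sym μ↭))) ⟩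
  a ∷ b ∷ μ                                                 ∎)
  where
  open ⊆-Reasoning ℕ
  λs⊆a∷b∷moved : λs ⊆ a ∷ b ∷ dropZeros (modifyAt j suc (modifyAt i (_∸ 1) λs))
  λs⊆a∷b∷moved = ⊆-++-dropZeros (a ∷ b ∷ []) positive (⊆-trans unshrink (∷⁺ʳ a ungrow))
MoveCell-⊇ {λs} {μ} positive (i , _ , inj₂ μ↭) with ⊆-modifyAt i (_∸ 1) λs
... | a , unshrink = a , a , (begin
  λs                                       ⊆⟨ ⊆-++-dropZeros (a ∷ []) positive unshrink ⟩
  a ∷ dropZeros (modifyAt i (_∸ 1) λs)     ⊆⟨ ∷⁺ʳ a there ⟩
  a ∷ 1 ∷ dropZeros (modifyAt i (_∸ 1) λs) ⊆⟨ ∷⁺ʳ a (⊆-reflexive-↭ (↭-sym μ↭)) ⟩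
  a ∷ μ                                    ⊆⟨ there ⟩
  a ∷ a ∷ μ                                ∎)
  where open ⊆-Reasoning ℕ

proposition6p2 : (n : ℕ) → 1 ≤ n → (r s : ℕ) → LevelAdj n r s →
    (r ∸ s ≤ 2) × (s ∸ r ≤ 2)
proposition6p2 _ _ _ _ (_ , _ , λs , μ , ((_ , positive , _) , _ , _ , move) , refl , refl)
  with MoveCell-⊇ positive move | MoveCell-⊆ move
... | a , b , λs⊆ | c , d , μ⊆ = σ-∸-≤ (a ∷ b ∷ []) {λs} {μ} λs⊆ , σ-∸-≤ (c ∷ d ∷ []) {μ} {λs} μ⊆
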